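{- For every $n\ge3$ and every tree topology $U$ with $n$ nodes, the polyhedron of the STT LP for $U$ has integer vertices (vertices all of whose coordinates are integers) that are not the point induced by any STT over $U$.
   Context: For a tree $U$ and distinct nodes $i,j$, $(i\leftrightsquigarrow j)$ denotes the nodes strictly between $i$ and $j$ on the $U$-path. An STT $T$ over $U$: pick a node $r$ as root; its subtrees are STTs built recursively over the components of $U\setminus\{r\}$. The STT LP for $U$ has variables $D_i$, $X_{ij}$ ($i\ne j$), $Z_{kij}=Z_{kji}$ ($k\in(i\leftrightsquigarrow j)$); constraints $X,Z\ge0$; $X_{ij}+X_{ji}+\sum_{k\in(i\leftrightsquigarrow j)}Z_{kij}\ge1$ for all $i\ne j$; $Z_{kij}\le X_{ki}$, $Z_{kij}\le X_{kj}$; $D_i\ge\sum_{j\ne i}X_{ji}$. The point induced by STT $T$ has $X_{ij}=1$ iff $i$ is a proper ancestor of $j$ in $T$, $Z_{kij}=1$ iff $k$ is the lowest common ancestor of $i,j$ in $T$, all other $X,Z$ zero, and $D_i=\sum_{j\ne i}X_{ji}$. -}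

module Defs where

open import Data.Nat using (ℕ; zero; suc)
open import Data.Fin using (Fin; zero; suc)
open import Data.Fin.Subset using (Subset; _∈_; _∉_; _⊆_; _∩_; _∪_; ⁅_⁆; ⊤; ⊥; Empty; Nonempty) renaming (_-_ to _∖_)
open import Data.Bool using (Bool; true; false)
open import Data.List using (List; []; _∷_)
open import Data.List.Membership.Propositional using () renaming (_∈_ to _∈ˡ_)
open import Data.List.Relation.Unary.All using (All)
open import Data.List.Relation.Unary.Any using (Any)
open import Data.List.Relation.Unary.AllPairs using (AllPairs)
open import Data.List.Relation.Unary.Unique.Propositional using (Unique)
open import Data.Integer using (ℤ)
open import Data.Rational using (ℚ; 0ℚ; 1ℚ; _+_; _-_; _≤_; _/_)
open import Data.Product using (Σ; ∃; _×_; _,_)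
open import Data.Sum using (_⊎_)
open import Data.Unit using () renaming (⊤ to Unit)
open import Relation.Binary.PropositionalEquality using (_≡_; _≢_)
open import Relation.Nullary using (¬_)

record Graph (n : ℕ) : Set where
  field
    Adj    : Fin n → Fin n → Bool
    sym    : ∀ i j → Adj i j ≡ Adj j i
    irrefl : ∀ i → Adj i i ≡ false

open Graph public

Edge : ∀ {n} → Graph n → Fin n → Fin n → Set
Edge G i j = Adj G i j ≡ true

data Walk {n} (G : Graph n) : Fin n → Fin n → Set where
  here : ∀ {i} → Walk G i i
  step : ∀ {i j k} → Edge G i j → Walk G j k → Walk G i k

nodes : ∀ {n} {G : Graph n} {i j} → Walk G i j → List (Fin n)
nodes {i = i} here       = i ∷ []
nodes {i = i} (step _ w) = i ∷ nodes w

IsPath : ∀ {n} {G : Graph n} {i j} → Walk G i j → Set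
IsPath w = Unique (nodes w)

IsTree : ∀ {n} → Graph n → Set
IsTree {n} G =
  (∀ (i j : Fin n) → Σ (Walk G i j) IsPath) ×
  (∀ (i j : Fin n) (p q : Walk G i j) → IsPath p → IsPath q → nodes p ≡ nodes q)

Between : ∀ {n} → Graph n → Fin n → Fin n → Fin n → Set
Between G k i j =
  Σ (Walk G i j) λ p → IsPath p × (k ∈ˡ nodes p) × (k ≢ i) × (k ≢ j)

WalkIn : ∀ {n} {G : Graph n} {i j} → Subset n → Walk G i j → Set
WalkIn S w = All (λ x → x ∈ S) (nodes w)

ConnectedIn : ∀ {n} → Graph n → Subset n → Set
ConnectedIn {n} G C = ∀ (i j : Fin n) → i ∈ C → j ∈ C → Σ (Walk G i j) (WalkIn C)

IsComponent : ∀ {n} → Graph n → Subset n → Subset n → Set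
IsComponent {n} G S C =
  C ⊆ S × Nonempty C × ConnectedIn G C ×
  (∀ (x y : Fin n) → x ∈ C → y ∈ S → Edge G x y → y ∈ C)

-- Search trees on trees (STTs), as rooted labelled rose trees

data RTree (n : ℕ) : Set where
  node : Fin n → List (RTree n) → RTree n

mutual
  nodeSet : ∀ {n} → RTree n → Subset n
  nodeSet (node r ts) = ⁅ r ⁆ ∪ nodeSetF ts

  nodeSetF : ∀ {n} → List (RTree n) → Subset n
  nodeSetF []       = ⊥
  nodeSetF (t ∷ ts) = nodeSet t ∪ nodeSetF ts

-- ValidSTT G S t : t is an STT over the subgraph of G induced by S:
-- its root r lies in S and its subtrees are STTs built over the
-- components of S ∖ {r}, each component used exactly once.
mutual
  ValidSTT : ∀ {n} → Graph n → Subset n → RTree n → Set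
  ValidSTT {n} G S (node r ts) =
    r ∈ S ×
    ValidKids G (S ∖ r) ts ×
    (∀ (x : Fin n) → x ∈ (S ∖ r) → Any (λ t → x ∈ nodeSet t) ts) ×
    AllPairs (λ t u → Empty (nodeSet t ∩ nodeSet u)) ts

  ValidKids : ∀ {n} → Graph n → Subset n → List (RTree n) → Set
  ValidKids G S' []       = Unit
  ValidKids G S' (t ∷ ts) =
    IsComponent G S' (nodeSet t) × ValidSTT G (nodeSet t) t × ValidKids G S' ts

IsSTT : ∀ {n} → Graph n → RTree n → Set
IsSTT G t = ValidSTT G ⊤ t

mutual
  Anc : ∀ {n} → RTree n → Fin n → Fin n → Set
  Anc (node r ts) a b = (a ≡ r × b ∈ nodeSetF ts) ⊎ AncF ts a b

  AncF : ∀ {n} → List (RTree n) → Fin n → Fin n → Set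
  AncF []       a b = Data.Empty.⊥
    where import Data.Empty
  AncF (t ∷ ts) a b = Anc t a b ⊎ AncF ts a b

AncEq : ∀ {n} → RTree n → Fin n → Fin n → Set
AncEq t a b = a ≡ b ⊎ Anc t a b

IsLCA : ∀ {n} → RTree n → Fin n → Fin n → Fin n → Set
IsLCA {n} t k i j =
  AncEq t k i × AncEq t k j ×
  (∀ (m : Fin n) → Anc t k m → ¬ (AncEq t m i × AncEq t m j))

sumℚ : ∀ {n} → (Fin n → ℚ) → ℚ
sumℚ {zero}  f = 0ℚ
sumℚ {suc n} f = f zero + sumℚ (λ i → f (suc i))

-- Only the coordinates that are
-- LP variables are meaningful; the others are pinned to 0 (and Z is
-- symmetric) by WellFormed, so well-formed points correspond exactly
-- to points of the LP's variable space.
record Point (n : ℕ) : Set where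
  constructor mkPoint
  field
    D : Fin n → ℚ
    X : Fin n → Fin n → ℚ
    Z : Fin n → Fin n → Fin n → ℚ

open Point public

WellFormed : ∀ {n} → Graph n → Point n → Set
WellFormed {n} G p =
  (∀ (i : Fin n) → X p i i ≡ 0ℚ) ×
  (∀ (k i j : Fin n) → ¬ Between G k i j → Z p k i j ≡ 0ℚ) ×
  (∀ (k i j : Fin n) → Z p k i j ≡ Z p k j i)

InLP : ∀ {n} → Graph n → Point n → Set
InLP {n} G p =
  WellFormed G p ×
  (∀ (i j : Fin n) → i ≢ j → 0ℚ ≤ X p i j) ×
  (∀ (k i j : Fin n) → Between G k i j → 0ℚ ≤ Z p k i j) ×
  (∀ (i j : Fin n) → i ≢ j →
     1ℚ ≤ X p i j + X p j i + sumℚ (λ k → Z p k i j)) ×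
  (∀ (k i j : Fin n) → Between G k i j →
     Z p k i j ≤ X p k i × Z p k i j ≤ X p k j) ×
  (∀ (i : Fin n) → sumℚ (λ j → X p j i) ≤ D p i)

_⊕_ : ∀ {n} → Point n → Point n → Point n
p ⊕ q = mkPoint (λ i → D p i + D q i) (λ i j → X p i j + X q i j)
                (λ k i j → Z p k i j + Z q k i j)

_⊖_ : ∀ {n} → Point n → Point n → Point n
p ⊖ q = mkPoint (λ i → D p i - D q i) (λ i j → X p i j - X q i j)
                (λ k i j → Z p k i j - Z q k i j)

IsZeroPoint : ∀ {n} → Point n → Set
IsZeroPoint {n} q =
  (∀ (i : Fin n) → D q i ≡ 0ℚ) ×
  (∀ (i j : Fin n) → X q i j ≡ 0ℚ) ×
  (∀ (k i j : Fin n) → Z q k i j ≡ 0ℚ)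

-- vertex (extreme point) of the polyhedron: p lies in it and is not the
-- midpoint of two distinct points of it
IsVertex : ∀ {n} → Graph n → Point n → Set
IsVertex G p =
  InLP G p ×
  (∀ q → InLP G (p ⊕ q) → InLP G (p ⊖ q) → IsZeroPoint q)

IsIntegerℚ : ℚ → Set
IsIntegerℚ x = Σ ℤ λ z → x ≡ z / 1

IntegerPoint : ∀ {n} → Point n → Set
IntegerPoint {n} p =
  (∀ (i : Fin n) → IsIntegerℚ (D p i)) ×
  (∀ (i j : Fin n) → IsIntegerℚ (X p i j)) ×
  (∀ (k i j : Fin n) → IsIntegerℚ (Z p k i j))

InducedBy : ∀ {n} → Graph n → RTree n → Point n → Set
InducedBy {n} G t p =
  WellFormed G p ×
  (∀ (i j : Fin n) → i ≢ j → (Anc t i j → X p i j ≡ 1ℚ) × (¬ Anc t i j → X p i j ≡ 0ℚ)) ×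
  (∀ (k i j : Fin n) → Between G k i j →
     (IsLCA t k i j → Z p k i j ≡ 1ℚ) × (¬ IsLCA t k i j → Z p k i j ≡ 0ℚ)) ×
  (∀ (i : Fin n) → D p i ≡ sumℚ (λ j → X p j i))

-- Orient the edges of the complete graph on the nodes as a tournament,
-- take X to be its adjacency matrix, Z = 0 and D the in-degrees.  Since
-- every pair of nodes is joined in exactly one direction, each covering
-- constraint is tight with one X equal to 1 and the other equal to 0;
-- together with the tight bounds X ≥ 0, Z ≥ 0 and the D constraints this
-- pins down every coordinate, so the point is an integer vertex of the LP
-- whatever the tree U.  The ancestor relation of an STT is transitive,
-- so the point induced by an STT has a transitive X; a tournament with a
-- directed triangle therefore gives a vertex not induced by any STT.
module Submission where

open import Defs hiding (sym)
open import Algebra.Properties.Group using (\\-leftDividesʳ; ⁻¹-involutive)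
open import Data.Bool using (Bool; true; false; not)
open import Data.Empty using (⊥-elim)
open import Data.Fin using (Fin; toℕ) renaming (zero to 0F; suc to sucF)
open import Data.Fin.Properties using (toℕ-injective; _≟_)
open import Data.Fin.Subset
  using (Subset; inside; outside; _∈_; _∉_; _─_; _∩_; ⁅_⁆; Empty)
open import Data.Fin.Subset.Properties
  using (x∈p∪q⁻; x∈p∪q⁺; x∈p∩q⁺; x∈⁅x⁆; ∉⊥)
import Data.Integer as ℤ
open import Data.List using (List; []; _∷_)
open import Data.List.Relation.Unary.All using (All; _∷_)
open import Data.List.Relation.Unary.AllPairs using (AllPairs; _∷_)
open import Data.Nat using (ℕ; zero; suc; _≤_; _<ᵇ_; z≤n; s≤s)
import Data.Nat.Coprimality as Coprimality
open import Data.Product using (Σ; _×_; _,_; proj₁; proj₂)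
open import Data.Rational using (ℚ; 0ℚ; 1ℚ; _+_; _-_; -_; _/_; mkℚ)
  renaming (_≤_ to _≤ℚ_)
open import Data.Rational.Properties as ℚ
  using (≤-refl; ≤-antisym; +-monoʳ-≤; +-identityˡ; +-identityʳ;
         neg-antimono-≤; nonNegative⁻¹; ↥p/↧p≡p; 1≢0; +-0-group)
open import Data.Sum using (_⊎_; inj₁; inj₂)
open import Data.Vec using (_∷_; here; there)
open import Function using (_∘_)
open import Relation.Binary.PropositionalEquality
  using (_≡_; _≢_; refl; sym; trans; cong; cong₂; subst; subst₂)
open import Relation.Nullary using (¬_; yes; no)
open import Relation.Nullary.Decidable using (decidable-stable)

c≤c+x⇒0≤x : ∀ c x → c ≤ℚ c + x → 0ℚ ≤ℚ x
c≤c+x⇒0≤x c x c≤c+x =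
  subst₂ _≤ℚ_ (ℚ.+-inverseˡ c) (\\-leftDividesʳ +-0-group c x) (+-monoʳ-≤ (- c) c≤c+x)

c≤c±x⇒x≡0 : ∀ c x → c ≤ℚ c + x → c ≤ℚ c - x → x ≡ 0ℚ
c≤c±x⇒x≡0 c x c≤c+x c≤c-x = ≤-antisym x≤0 (c≤c+x⇒0≤x c x c≤c+x)
  where
  x≤0 : x ≤ℚ 0ℚ
  x≤0 = subst (_≤ℚ 0ℚ) (⁻¹-involutive +-0-group x)
          (neg-antimono-≤ (c≤c+x⇒0≤x c (- x) c≤c-x))

0+x≡0⇒x≡0 : ∀ {x} → 0ℚ + x ≡ 0ℚ → x ≡ 0ℚ
0+x≡0⇒x≡0 {x} = trans (sym (+-identityˡ x))

sumℚ-cong : ∀ {n} {f g : Fin n → ℚ} → (∀ k → f k ≡ g k) → sumℚ f ≡ sumℚ g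
sumℚ-cong {zero}  f≗g = refl
sumℚ-cong {suc n} f≗g = cong₂ _+_ (f≗g 0F) (sumℚ-cong (λ k → f≗g (sucF k)))

sumℚ-zero : ∀ {n} {f : Fin n → ℚ} → (∀ k → f k ≡ 0ℚ) → sumℚ f ≡ 0ℚ
sumℚ-zero {zero}  f≗0 = refl
sumℚ-zero {suc n} f≗0 = cong₂ _+_ (f≗0 0F) (sumℚ-zero (λ k → f≗0 (sucF k)))

-- z / 1 is already in normal form, so the sum of two such fractions
-- computes to a fraction with denominator 1.
z/1≡mkℚ : ∀ z → z / 1 ≡ mkℚ z 0 (Coprimality.sym (Coprimality.1-coprimeTo _))
z/1≡mkℚ z = ↥p/↧p≡p (mkℚ z 0 (Coprimality.sym (Coprimality.1-coprimeTo _)))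

IsIntegerℚ-+ : ∀ {x y} → IsIntegerℚ x → IsIntegerℚ y → IsIntegerℚ (x + y)
IsIntegerℚ-+ (a , refl) (b , refl) rewrite z/1≡mkℚ a | z/1≡mkℚ b =
  a ℤ.* ℤ.1ℤ ℤ.+ b ℤ.* ℤ.1ℤ , refl

IsIntegerℚ-sumℚ : ∀ {n} {f : Fin n → ℚ} →
  (∀ k → IsIntegerℚ (f k)) → IsIntegerℚ (sumℚ f)
IsIntegerℚ-sumℚ {zero}  _     = ℤ.0ℤ , refl
IsIntegerℚ-sumℚ {suc n} f-int =
  IsIntegerℚ-+ (f-int 0F) (IsIntegerℚ-sumℚ (λ k → f-int (sucF k)))

x∈p─q⇒x∉q : ∀ {n} (p q : Subset n) {x} → x ∈ p ─ q → x ∉ q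
x∈p─q⇒x∉q (inside ∷ p) (outside ∷ q) here ()
x∈p─q⇒x∉q (_ ∷ p)      (_ ∷ q)       (there x∈p─q) (there x∈q) =
  x∈p─q⇒x∉q p q x∈p─q x∈q

x∈p-y⇒x≢y : ∀ {n} {p : Subset n} {x y} → x ∈ p ─ ⁅ y ⁆ → x ≢ y
x∈p-y⇒x≢y {p = p} {y = y} x∈p-y refl = x∈p─q⇒x∉q p ⁅ y ⁆ x∈p-y (x∈⁅x⁆ y)

mutual
  Anc⇒∈ˡ : ∀ {n} (t : RTree n) {a b} → Anc t a b → a ∈ nodeSet t
  Anc⇒∈ˡ (node r ts) (inj₁ (refl , _)) = x∈p∪q⁺ (inj₁ (x∈⁅x⁆ r))
  Anc⇒∈ˡ (node r ts) (inj₂ anc)        = x∈p∪q⁺ (inj₂ (AncF⇒∈ˡ ts anc))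

  AncF⇒∈ˡ : ∀ {n} (ts : List (RTree n)) {a b} → AncF ts a b → a ∈ nodeSetF ts
  AncF⇒∈ˡ (t ∷ ts) (inj₁ anc) = x∈p∪q⁺ (inj₁ (Anc⇒∈ˡ t anc))
  AncF⇒∈ˡ (t ∷ ts) (inj₂ anc) = x∈p∪q⁺ (inj₂ (AncF⇒∈ˡ ts anc))

mutual
  Anc⇒∈ʳ : ∀ {n} (t : RTree n) {a b} → Anc t a b → b ∈ nodeSet t
  Anc⇒∈ʳ (node r ts) (inj₁ (_ , b∈ts)) = x∈p∪q⁺ (inj₂ b∈ts)
  Anc⇒∈ʳ (node r ts) (inj₂ anc)        = x∈p∪q⁺ (inj₂ (AncF⇒∈ʳ ts anc))

  AncF⇒∈ʳ : ∀ {n} (ts : List (RTree n)) {a b} → AncF ts a b → b ∈ nodeSetF ts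
  AncF⇒∈ʳ (t ∷ ts) (inj₁ anc) = x∈p∪q⁺ (inj₁ (Anc⇒∈ʳ t anc))
  AncF⇒∈ʳ (t ∷ ts) (inj₂ anc) = x∈p∪q⁺ (inj₂ (AncF⇒∈ʳ ts anc))

ValidKids⇒⊆ : ∀ {n} {G : Graph n} {S} (ts : List (RTree n)) → ValidKids G S ts →
  ∀ {x} → x ∈ nodeSetF ts → x ∈ S
ValidKids⇒⊆ []       _                  x∈⊥ = ⊥-elim (∉⊥ x∈⊥)
ValidKids⇒⊆ (t ∷ ts) (t-comp , _ , vts) x∈ with x∈p∪q⁻ (nodeSet t) (nodeSetF ts) x∈
... | inj₁ x∈t  = proj₁ t-comp x∈t
... | inj₂ x∈ts = ValidKids⇒⊆ ts vts x∈ts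

disjoint⇒∉nodeSetF : ∀ {n} (p : Subset n) (us : List (RTree n)) →
  All (λ u → Empty (p ∩ nodeSet u)) us → ∀ {x} → x ∈ p → x ∉ nodeSetF us
disjoint⇒∉nodeSetF p []       _                 _   x∈⊥ = ∉⊥ x∈⊥
disjoint⇒∉nodeSetF p (u ∷ us) (p∩u≡∅ ∷ p∩us≡∅) x∈p x∈
  with x∈p∪q⁻ (nodeSet u) (nodeSetF us) x∈
... | inj₁ x∈u  = p∩u≡∅ (_ , x∈p∩q⁺ (x∈p , x∈u))
... | inj₂ x∈us = disjoint⇒∉nodeSetF p us p∩us≡∅ x∈p x∈us

mutual
  Anc-trans : ∀ {n} {G : Graph n} {S} (t : RTree n) → ValidSTT G S t →
    ∀ {a b c} → Anc t a b → Anc t b c → Anc t a c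
  Anc-trans (node r ts) (_ , vts , _ , _) (inj₁ (_ , b∈ts)) (inj₁ (refl , _)) =
    ⊥-elim (x∈p-y⇒x≢y (ValidKids⇒⊆ ts vts b∈ts) refl)
  Anc-trans (node r ts) _ (inj₁ (a≡r , _)) (inj₂ bc) = inj₁ (a≡r , AncF⇒∈ʳ ts bc)
  Anc-trans (node r ts) (_ , vts , _ , _) (inj₂ ab) (inj₁ (refl , _)) =
    ⊥-elim (x∈p-y⇒x≢y (ValidKids⇒⊆ ts vts (AncF⇒∈ʳ ts ab)) refl)
  Anc-trans (node r ts) (_ , vts , _ , disj) (inj₂ ab) (inj₂ bc) =
    inj₂ (AncF-trans ts vts disj ab bc)

  AncF-trans : ∀ {n} {G : Graph n} {S} (ts : List (RTree n)) → ValidKids G S ts →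
    AllPairs (λ t u → Empty (nodeSet t ∩ nodeSet u)) ts →
    ∀ {a b c} → AncF ts a b → AncF ts b c → AncF ts a c
  AncF-trans (t ∷ ts) (_ , vt , _)   _            (inj₁ ab) (inj₁ bc) =
    inj₁ (Anc-trans t vt ab bc)
  AncF-trans (t ∷ ts) _              (disj ∷ _)   (inj₁ ab) (inj₂ bc) =
    ⊥-elim (disjoint⇒∉nodeSetF (nodeSet t) ts disj (Anc⇒∈ʳ t ab) (AncF⇒∈ˡ ts bc))
  AncF-trans (t ∷ ts) _              (disj ∷ _)   (inj₂ ab) (inj₁ bc) =
    ⊥-elim (disjoint⇒∉nodeSetF (nodeSet t) ts disj (Anc⇒∈ˡ t bc) (AncF⇒∈ʳ ts ab))
  AncF-trans (t ∷ ts) (_ , _ , vts) (_ ∷ disjs) (inj₂ ab) (inj₂ bc) =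
    inj₂ (AncF-trans ts vts disjs ab bc)

Induced⇒X-transitive : ∀ {n} {G : Graph n} {S t p} → ValidSTT G S t → InducedBy G t p →
  ∀ {a b c} → a ≢ c → X p a b ≡ 1ℚ → X p b c ≡ 1ℚ → X p a c ≢ 0ℚ
Induced⇒X-transitive {t = t} {p} vt ((X-diag , _) , X-Anc , _) a≢c ab≡1 bc≡1 ac≡0 =
  ¬¬Anc ab≡1 λ ab → ¬¬Anc bc≡1 λ bc →
    1≢0 (trans (sym (proj₁ (X-Anc _ _ a≢c) (Anc-trans t vt ab bc))) ac≡0)
  where
  ¬¬Anc : ∀ {i j} → X p i j ≡ 1ℚ → ¬ ¬ Anc t i j
  ¬¬Anc {i} {j} ij≡1 ¬anc with i ≟ j
  ... | yes refl = 1≢0 (trans (sym ij≡1) (X-diag i))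
  ... | no i≢j   = 1≢0 (trans (sym ij≡1) (proj₂ (X-Anc i j i≢j) ¬anc))

record Tournament (n : ℕ) : Set where
  field
    beats        : Fin n → Fin n → Bool
    beats-irrefl : ∀ i → beats i i ≡ false
    beats-flip   : ∀ {i j} → i ≢ j → beats j i ≡ not (beats i j)

bool→ℚ : Bool → ℚ
bool→ℚ true  = 1ℚ
bool→ℚ false = 0ℚ

module _ {n} (T : Tournament n) where
  open Tournament T

  adjacency : Fin n → Fin n → ℚ
  adjacency i j = bool→ℚ (beats i j)

  tournamentPoint : Point n
  tournamentPoint = mkPoint (λ i → sumℚ (λ j → adjacency j i)) adjacency (λ _ _ _ → 0ℚ)

  adjacency-diag : ∀ i → adjacency i i ≡ 0ℚ
  adjacency-diag i = cong bool→ℚ (beats-irrefl i)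

  adjacency-nonneg : ∀ i j → 0ℚ ≤ℚ adjacency i j
  adjacency-nonneg i j with beats i j
  ... | true  = nonNegative⁻¹ 1ℚ
  ... | false = ≤-refl

  adjacency-integer : ∀ i j → IsIntegerℚ (adjacency i j)
  adjacency-integer i j with beats i j
  ... | true  = ℤ.1ℤ , refl
  ... | false = ℤ.0ℤ , refl

  adjacency-pair : ∀ {i j} → i ≢ j →
    (adjacency i j ≡ 0ℚ × adjacency j i ≡ 1ℚ) ⊎ (adjacency i j ≡ 1ℚ × adjacency j i ≡ 0ℚ)
  adjacency-pair {i} {j} i≢j with beats i j | beats-flip i≢j
  ... | true  | ji≡false = inj₂ (refl , cong bool→ℚ ji≡false)
  ... | false | ji≡true  = inj₁ (refl , cong bool→ℚ ji≡true)

  tournamentPoint-integer : IntegerPoint tournamentPoint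
  tournamentPoint-integer =
    (λ i → IsIntegerℚ-sumℚ (λ j → adjacency-integer j i)) ,
    adjacency-integer ,
    (λ _ _ _ → ℤ.0ℤ , refl)

  tournamentPoint-InLP : ∀ G → InLP G tournamentPoint
  tournamentPoint-InLP G =
    (adjacency-diag , (λ _ _ _ _ → refl) , (λ _ _ _ → refl)) ,
    (λ i j _ → adjacency-nonneg i j) ,
    (λ _ _ _ _ → ≤-refl) ,
    (λ i j i≢j → covered (adjacency-pair i≢j) (sumℚ-zero {n} (λ _ → refl))) ,
    (λ k i j _ → adjacency-nonneg k i , adjacency-nonneg k j) ,
    (λ _ → ≤-refl)
    where
    covered : ∀ {a b s} → (a ≡ 0ℚ × b ≡ 1ℚ) ⊎ (a ≡ 1ℚ × b ≡ 0ℚ) → s ≡ 0ℚ →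
      1ℚ ≤ℚ a + b + s
    covered (inj₁ (refl , refl)) refl = ≤-refl
    covered (inj₂ (refl , refl)) refl = ≤-refl

  tournamentPoint-vertex : ∀ G → IsVertex G tournamentPoint
  tournamentPoint-vertex G = tournamentPoint-InLP G , rigid
    where
    p = tournamentPoint

    rigid : ∀ q → InLP G (p ⊕ q) → InLP G (p ⊖ q) → IsZeroPoint q
    rigid q ((X⁺-diag , Z⁺-off , _) , X⁺-nonneg , Z⁺-nonneg , X⁺-cover , _ , D⁺-bound)
            ((_       , _      , _) , X⁻-nonneg , Z⁻-nonneg , X⁻-cover , _ , D⁻-bound) =
      D≡0 , X≡0 , Z≡0
      where
      -- Between is not decidable, but equality of rationals is.
      Z≡0 : ∀ k i j → Z q k i j ≡ 0ℚ
      Z≡0 k i j = decidable-stable (Z q k i j ℚ.≟ 0ℚ) λ Z≢0 →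
        Z≢0 (0+x≡0⇒x≡0 (Z⁺-off k i j λ btw →
          Z≢0 (c≤c±x⇒x≡0 0ℚ _ (Z⁺-nonneg k i j btw) (Z⁻-nonneg k i j btw))))

      X≡0-where-0 : ∀ {i j} → i ≢ j → adjacency i j ≡ 0ℚ → X q i j ≡ 0ℚ
      X≡0-where-0 {i} {j} i≢j ij≡0 = c≤c±x⇒x≡0 0ℚ _
        (subst (λ a → 0ℚ ≤ℚ a + X q i j) ij≡0 (X⁺-nonneg i j i≢j))
        (subst (λ a → 0ℚ ≤ℚ a - X q i j) ij≡0 (X⁻-nonneg i j i≢j))

      tight-cover : ∀ {a b x y s} → a ≡ 1ℚ → b ≡ 0ℚ → y ≡ 0ℚ → s ≡ 0ℚ →
        1ℚ ≤ℚ a + x + (b + y) + s → 1ℚ ≤ℚ 1ℚ + x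
      tight-cover {x = x} refl refl refl refl =
        subst (1ℚ ≤ℚ_) (trans (+-identityʳ _) (+-identityʳ (1ℚ + x)))

      X≡0-where-1 : ∀ {i j} → i ≢ j →
        adjacency i j ≡ 1ℚ → adjacency j i ≡ 0ℚ → X q i j ≡ 0ℚ
      X≡0-where-1 {i} {j} i≢j ij≡1 ji≡0 = c≤c±x⇒x≡0 1ℚ _
        (tight-cover ij≡1 ji≡0 Xji≡0          Z⁺-sum≡0 (X⁺-cover i j i≢j))
        (tight-cover ij≡1 ji≡0 (cong -_ Xji≡0) Z⁻-sum≡0 (X⁻-cover i j i≢j))
        where
        Xji≡0 : X q j i ≡ 0ℚ
        Xji≡0 = X≡0-where-0 (i≢j ∘ sym) ji≡0

        Z⁺-sum≡0 : sumℚ (λ k → 0ℚ + Z q k i j) ≡ 0ℚ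
        Z⁺-sum≡0 = sumℚ-zero λ k → cong (0ℚ +_) (Z≡0 k i j)

        Z⁻-sum≡0 : sumℚ (λ k → 0ℚ - Z q k i j) ≡ 0ℚ
        Z⁻-sum≡0 = sumℚ-zero λ k → cong (λ z → 0ℚ - z) (Z≡0 k i j)

      X≡0 : ∀ i j → X q i j ≡ 0ℚ
      X≡0 i j with i ≟ j
      ... | yes refl =
        0+x≡0⇒x≡0 (subst (λ a → a + X q i i ≡ 0ℚ) (adjacency-diag i) (X⁺-diag i))
      ... | no i≢j with adjacency-pair i≢j
      ...   | inj₁ (ij≡0 , _)    = X≡0-where-0 i≢j ij≡0
      ...   | inj₂ (ij≡1 , ji≡0) = X≡0-where-1 i≢j ij≡1 ji≡0

      D≡0 : ∀ i → D q i ≡ 0ℚ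
      D≡0 i = c≤c±x⇒x≡0 in-degree (D q i)
        (subst (_≤ℚ in-degree + D q i) (unperturbed _+_ +-identityʳ) (D⁺-bound i))
        (subst (_≤ℚ in-degree - D q i) (unperturbed _-_ +-identityʳ) (D⁻-bound i))
        where
        in-degree : ℚ
        in-degree = sumℚ (λ j → adjacency j i)

        unperturbed : (_∙_ : ℚ → ℚ → ℚ) → (∀ a → a ∙ 0ℚ ≡ a) →
          sumℚ (λ j → adjacency j i ∙ X q j i) ≡ in-degree
        unperturbed _∙_ ∙-identityʳ =
          sumℚ-cong λ j → trans (cong (adjacency j i ∙_) (X≡0 j i)) (∙-identityʳ _)
  triangle⇒¬Induced : ∀ {G : Graph n} {S t a b c} →
    beats a b ≡ true → beats b c ≡ true → beats c a ≡ true →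
    ValidSTT G S t → ¬ InducedBy G t tournamentPoint
  triangle⇒¬Induced {a = a} {c = c} ab bc ca vt induced =
    Induced⇒X-transitive vt induced a≢c (cong bool→ℚ ab) (cong bool→ℚ bc)
      (cong bool→ℚ (trans (beats-flip (a≢c ∘ sym)) (cong not ca)))
    where
    a≢c : a ≢ c
    a≢c refl with trans (sym ca) (beats-irrefl a)
    ... | ()

<ᵇ-irrefl : ∀ m → (m <ᵇ m) ≡ false
<ᵇ-irrefl zero    = refl
<ᵇ-irrefl (suc m) = <ᵇ-irrefl m

<ᵇ-flip : ∀ {m n} → m ≢ n → (n <ᵇ m) ≡ not (m <ᵇ n)
<ᵇ-flip {zero}  {zero}  m≢n = ⊥-elim (m≢n refl)
<ᵇ-flip {zero}  {suc n} _   = refl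
<ᵇ-flip {suc m} {zero}  _   = refl
<ᵇ-flip {suc m} {suc n} m≢n = <ᵇ-flip (m≢n ∘ cong suc)

-- The usual order on ℕ with the arc between 0 and 2 reversed: 0 → 1 → 2 → 0.
triangle : ℕ → ℕ → Bool
triangle 0 2 = false
triangle 2 0 = true
triangle m n = m <ᵇ n

triangle-irrefl : ∀ m → triangle m m ≡ false
triangle-irrefl 0 = refl
triangle-irrefl 1 = refl
triangle-irrefl 2 = refl
triangle-irrefl (suc (suc (suc m))) = <ᵇ-irrefl m

triangle-flip : ∀ {m n} → m ≢ n → triangle n m ≡ not (triangle m n)
triangle-flip {0} {0} m≢n = ⊥-elim (m≢n refl)
triangle-flip {1} {1} m≢n = ⊥-elim (m≢n refl)
triangle-flip {2} {2} m≢n = ⊥-elim (m≢n refl)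
triangle-flip {0} {1} _ = refl
triangle-flip {0} {2} _ = refl
triangle-flip {0} {suc (suc (suc n))} _ = refl
triangle-flip {1} {0} _ = refl
triangle-flip {1} {2} _ = refl
triangle-flip {1} {suc (suc (suc n))} _ = refl
triangle-flip {2} {0} _ = refl
triangle-flip {2} {1} _ = refl
triangle-flip {2} {suc (suc (suc n))} _ = refl
triangle-flip {suc (suc (suc m))} {0} _ = refl
triangle-flip {suc (suc (suc m))} {1} _ = refl
triangle-flip {suc (suc (suc m))} {2} _ = refl
triangle-flip {suc (suc (suc m))} {suc (suc (suc n))} m≢n =
  <ᵇ-flip (m≢n ∘ cong (suc ∘ suc ∘ suc))

triangleTournament : ∀ n → Tournament n
triangleTournament n = record
  { beats        = λ i j → triangle (toℕ i) (toℕ j)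
  ; beats-irrefl = λ i → triangle-irrefl (toℕ i)
  ; beats-flip   = λ i≢j → triangle-flip (i≢j ∘ toℕ-injective)
  }

theorem3p7 : (n : ℕ) → 3 ≤ n → (U : Graph n) → IsTree U →
    Σ (Point n) λ p → IsVertex U p × IntegerPoint p ×
      ((T : RTree n) → IsSTT U T → ¬ InducedBy U T p)
theorem3p7 n@(suc (suc (suc _))) (s≤s (s≤s (s≤s z≤n))) U _ =
  tournamentPoint Δ ,
  tournamentPoint-vertex Δ U ,
  tournamentPoint-integer Δ ,
  λ T isSTT →
    triangle⇒¬Induced Δ {a = 0F} {b = sucF 0F} {c = sucF (sucF 0F)} refl refl refl isSTT
  where
  Δ : Tournament n
  Δ = triangleTournament n
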